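{- For all propositions $A,B$ and proof-terms $t_1,t_2$: if $t_1\in[\![A]\!]$ and $t_2\in[\![B]\!]$, then $t_1+t_2\in[\![A\odot B]\!]$.
   Context: The $\odot$-calculus. Propositions: $A ::= \top \mid \bot \mid A \Rightarrow A \mid A \wedge A \mid A \vee A \mid A \odot A$. Proof-terms: $t ::= x \mid t \parallel u \mid * \mid \delta_\bot(t) \mid \lambda x\, t \mid t\,u \mid \langle t,u\rangle \mid \delta_\wedge(t,[x,y]u) \mid \mathrm{inl}(t) \mid \mathrm{inr}(t) \mid \delta_\vee(t,[x]u,[y]v) \mid t+u \mid \delta_\odot(t,[x]u,[y]v) \mid \delta_\odot^\parallel(t,[x]u,[y]v)$, where $\lambda x$ binds $x$, $[x,y]$ binds $x,y$, and $[x]$, $[y]$ bind $x$, $y$; $(u/x)t$ is capture-avoiding substitution. Ultra-reduction $\longrightarrow$ is the smallest contextual relation (closed under all term constructors) containing $\sigma l\to\sigma r$ for every substitution $\sigma$ and every rule $l\to r$ among: $(\lambda x\,t)\,u\to(u/x)t$; $\delta_\wedge(\langle t,u\rangle,[x,y]v)\to(t/x,u/y)v$; $\delta_\vee(\mathrm{inl}(t),[x]v,[y]w)\to(t/x)v$; $\delta_\vee(\mathrm{inr}(u),[x]v,[y]w)\to(u/y)w$; $\delta_\odot(t+u,[x]v,[y]w)\to(t/x)v$; $\delta_\odot(t+u,[x]v,[y]w)\to(u/y)w$; $\delta_\odot^\parallel(t+u,[x]v,[y]w)\to(t/x)v\parallel(u/y)w$; $(\lambda x\,t)\parallel(\lambda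 x\,u)\to\lambda x\,(t\parallel u)$; $\langle t,u\rangle\parallel\langle v,w\rangle\to\langle t\parallel v,u\parallel w\rangle$; $\delta_\vee(t\parallel u,[x]v,[y]w)\to\delta_\vee(t,[x]v,[y]w)\parallel\delta_\vee(u,[x]v,[y]w)$; $(t+u)\parallel(v+w)\to(t\parallel v)+(u\parallel w)$; $t\parallel t\to t$; $t\parallel u\to t$; $t\parallel u\to u$. $\longrightarrow^*$ is its reflexive-transitive closure; $t$ strongly terminates if there is no infinite ultra-reduction sequence from $t$. Sets $[\![A]\!]$ are defined by induction on $A$: $t\in[\![\top]\!]$ and $t\in[\![\bot]\!]$ iff $t$ strongly terminates; $t\in[\![A\Rightarrow B]\!]$ iff $t$ strongly terminates and whenever $t\longrightarrow^*\lambda x\,u$, then $(v/x)u\in[\![B]\!]$ for every $v\in[\![A]\!]$; $t\in[\![A\wedge B]\!]$ iff $t$ strongly terminates and whenever $t\longrightarrow^*\langle u,v\rangle$, then $u\in[\![A]\!]$ and $v\in[\![B]\!]$; $t\in[\![A\vee B]\!]$ iff $t$ strongly terminates, whenever $t\longrightarrow^*\mathrm{inl}(u)$ then $u\in[\![A]\!]$, and whenever $t\longrightarrow^*\mathrm{inr}(v)$ then $v\in[\![B]\!]$; $t\in[\![A\odot B]\!]$ iff $t$ strongly terminates and whenever $t\longrightarrow^* u+v$, then $u\in[\![A]\!]$ and $v\in[\![B]\!]$. -}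

module Defs where

open import Data.Nat using (ℕ; zero; suc)
open import Data.Fin using (Fin; zero; suc)
open import Data.Product using (_×_)
open import Induction.WellFounded using (Acc)
open import Relation.Binary.Construct.Closure.ReflexiveTransitive using (Star)

data Prop : Set where
  ⊤′ ⊥′ : Prop
  _⇒_ _∧_ _∨_ _⊙_ : Prop → Prop → Prop

-- Proof-terms, well-scoped de Bruijn syntax: Term n has n free variables.
-- Binders: lam binds 1; δ∧ binds 2 in its body ([x,y]: x = var 1, y = var 0);
-- δ∨, δ⊙, δ⊙∥ bind 1 in each branch.
data Term (n : ℕ) : Set where
  var   : Fin n → Term n
  _∥_   : Term n → Term n → Term n
  star  : Term n
  δ⊥    : Term n → Term n
  lam   : Term (suc n) → Term n
  app   : Term n → Term n → Term n
  pair  : Term n → Term n → Term n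
  δ∧    : Term n → Term (suc (suc n)) → Term n
  inl   : Term n → Term n
  inr   : Term n → Term n
  δ∨    : Term n → Term (suc n) → Term (suc n) → Term n
  _⊕_   : Term n → Term n → Term n       -- the paper's  t + u
  δ⊙    : Term n → Term (suc n) → Term (suc n) → Term n
  δ⊙∥   : Term n → Term (suc n) → Term (suc n) → Term n

Ren : ℕ → ℕ → Set
Ren m n = Fin m → Fin n

ext : ∀ {m n} → Ren m n → Ren (suc m) (suc n)
ext ρ zero    = zero
ext ρ (suc i) = suc (ρ i)

rename : ∀ {m n} → Ren m n → Term m → Term n
rename ρ (var i)        = var (ρ i)
rename ρ (t ∥ u)        = rename ρ t ∥ rename ρ u
rename ρ star           = star
rename ρ (δ⊥ t)         = δ⊥ (rename ρ t)
rename ρ (lam t)        = lam (rename (ext ρ) t)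
rename ρ (app t u)      = app (rename ρ t) (rename ρ u)
rename ρ (pair t u)     = pair (rename ρ t) (rename ρ u)
rename ρ (δ∧ t u)       = δ∧ (rename ρ t) (rename (ext (ext ρ)) u)
rename ρ (inl t)        = inl (rename ρ t)
rename ρ (inr t)        = inr (rename ρ t)
rename ρ (δ∨ t u v)     = δ∨ (rename ρ t) (rename (ext ρ) u) (rename (ext ρ) v)
rename ρ (t ⊕ u)        = rename ρ t ⊕ rename ρ u
rename ρ (δ⊙ t u v)     = δ⊙ (rename ρ t) (rename (ext ρ) u) (rename (ext ρ) v)
rename ρ (δ⊙∥ t u v)    = δ⊙∥ (rename ρ t) (rename (ext ρ) u) (rename (ext ρ) v)

Sub : ℕ → ℕ → Set
Sub m n = Fin m → Term n

exts : ∀ {m n} → Sub m n → Sub (suc m) (suc n)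
exts σ zero    = var zero
exts σ (suc i) = rename suc (σ i)

subst : ∀ {m n} → Sub m n → Term m → Term n
subst σ (var i)        = σ i
subst σ (t ∥ u)        = subst σ t ∥ subst σ u
subst σ star           = star
subst σ (δ⊥ t)         = δ⊥ (subst σ t)
subst σ (lam t)        = lam (subst (exts σ) t)
subst σ (app t u)      = app (subst σ t) (subst σ u)
subst σ (pair t u)     = pair (subst σ t) (subst σ u)
subst σ (δ∧ t u)       = δ∧ (subst σ t) (subst (exts (exts σ)) u)
subst σ (inl t)        = inl (subst σ t)
subst σ (inr t)        = inr (subst σ t)
subst σ (δ∨ t u v)     = δ∨ (subst σ t) (subst (exts σ) u) (subst (exts σ) v)
subst σ (t ⊕ u)        = subst σ t ⊕ subst σ u
subst σ (δ⊙ t u v)     = δ⊙ (subst σ t) (subst (exts σ) u) (subst (exts σ) v)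
subst σ (δ⊙∥ t u v)    = δ⊙∥ (subst σ t) (subst (exts σ) u) (subst (exts σ) v)

_[_] : ∀ {n} → Term (suc n) → Term n → Term n
t [ u ] = subst σ t
  where
  σ : Sub _ _
  σ zero    = u
  σ (suc i) = var i

_[_,_] : ∀ {n} → Term (suc (suc n)) → Term n → Term n → Term n
v [ t , u ] = subst σ v
  where
  σ : Sub _ _
  σ zero          = u
  σ (suc zero)    = t
  σ (suc (suc i)) = var i

infix 4 _⟶_
data _⟶_ {n : ℕ} : Term n → Term n → Set where
  β      : ∀ {t u} → app (lam t) u ⟶ t [ u ]
  β∧     : ∀ {t u v} → δ∧ (pair t u) v ⟶ v [ t , u ]
  β∨l    : ∀ {t v w} → δ∨ (inl t) v w ⟶ v [ t ]
  β∨r    : ∀ {u v w} → δ∨ (inr u) v w ⟶ w [ u ]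
  β⊙l    : ∀ {t u v w} → δ⊙ (t ⊕ u) v w ⟶ v [ t ]
  β⊙r    : ∀ {t u v w} → δ⊙ (t ⊕ u) v w ⟶ w [ u ]
  β⊙∥    : ∀ {t u v w} → δ⊙∥ (t ⊕ u) v w ⟶ (v [ t ]) ∥ (w [ u ])
  ∥lam   : ∀ {t u} → lam t ∥ lam u ⟶ lam (t ∥ u)
  ∥pair  : ∀ {t u v w} → pair t u ∥ pair v w ⟶ pair (t ∥ v) (u ∥ w)
  ∥δ∨    : ∀ {t u v w} → δ∨ (t ∥ u) v w ⟶ δ∨ t v w ∥ δ∨ u v w
  ∥⊕     : ∀ {t u v w} → (t ⊕ u) ∥ (v ⊕ w) ⟶ (t ∥ v) ⊕ (u ∥ w)
  ∥idem  : ∀ {t} → t ∥ t ⟶ t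
  ∥projl : ∀ {t u} → t ∥ u ⟶ t
  ∥projr : ∀ {t u} → t ∥ u ⟶ u
  ∥₁   : ∀ {t t′ u} → t ⟶ t′ → t ∥ u ⟶ t′ ∥ u
  ∥₂   : ∀ {t u u′} → u ⟶ u′ → t ∥ u ⟶ t ∥ u′
  δ⊥₁  : ∀ {t t′} → t ⟶ t′ → δ⊥ t ⟶ δ⊥ t′
  lam₁ : ∀ {t t′} → t ⟶ t′ → lam t ⟶ lam t′
  app₁ : ∀ {t t′ u} → t ⟶ t′ → app t u ⟶ app t′ u
  app₂ : ∀ {t u u′} → u ⟶ u′ → app t u ⟶ app t u′
  pair₁ : ∀ {t t′ u} → t ⟶ t′ → pair t u ⟶ pair t′ u
  pair₂ : ∀ {t u u′} → u ⟶ u′ → pair t u ⟶ pair t u′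
  δ∧₁  : ∀ {t t′ u} → t ⟶ t′ → δ∧ t u ⟶ δ∧ t′ u
  δ∧₂  : ∀ {t u u′} → u ⟶ u′ → δ∧ t u ⟶ δ∧ t u′
  inl₁ : ∀ {t t′} → t ⟶ t′ → inl t ⟶ inl t′
  inr₁ : ∀ {t t′} → t ⟶ t′ → inr t ⟶ inr t′
  δ∨₁  : ∀ {t t′ u v} → t ⟶ t′ → δ∨ t u v ⟶ δ∨ t′ u v
  δ∨₂  : ∀ {t u u′ v} → u ⟶ u′ → δ∨ t u v ⟶ δ∨ t u′ v
  δ∨₃  : ∀ {t u v v′} → v ⟶ v′ → δ∨ t u v ⟶ δ∨ t u v′
  ⊕₁   : ∀ {t t′ u} → t ⟶ t′ → t ⊕ u ⟶ t′ ⊕ u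
  ⊕₂   : ∀ {t u u′} → u ⟶ u′ → t ⊕ u ⟶ t ⊕ u′
  δ⊙₁  : ∀ {t t′ u v} → t ⟶ t′ → δ⊙ t u v ⟶ δ⊙ t′ u v
  δ⊙₂  : ∀ {t u u′ v} → u ⟶ u′ → δ⊙ t u v ⟶ δ⊙ t u′ v
  δ⊙₃  : ∀ {t u v v′} → v ⟶ v′ → δ⊙ t u v ⟶ δ⊙ t u v′
  δ⊙∥₁ : ∀ {t t′ u v} → t ⟶ t′ → δ⊙∥ t u v ⟶ δ⊙∥ t′ u v
  δ⊙∥₂ : ∀ {t u u′ v} → u ⟶ u′ → δ⊙∥ t u v ⟶ δ⊙∥ t u′ v
  δ⊙∥₃ : ∀ {t u v v′} → v ⟶ v′ → δ⊙∥ t u v ⟶ δ⊙∥ t u v′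

infix 4 _⟶*_
_⟶*_ : ∀ {n} → Term n → Term n → Set
_⟶*_ = Star _⟶_

_⟵_ : ∀ {n} → Term n → Term n → Set
u ⟵ t = t ⟶ u

SN : ∀ {n} → Term n → Set
SN = Acc _⟵_

⟦_⟧ : Prop → ∀ {n} → Term n → Set
⟦ ⊤′ ⟧ t = SN t
⟦ ⊥′ ⟧ t = SN t
⟦ A ⇒ B ⟧ t = SN t × (∀ u → t ⟶* lam u → ∀ v → ⟦ A ⟧ v → ⟦ B ⟧ (u [ v ]))
⟦ A ∧ B ⟧ t = SN t × (∀ u v → t ⟶* pair u v → ⟦ A ⟧ u × ⟦ B ⟧ v)
⟦ A ∨ B ⟧ t = SN t × (∀ u → t ⟶* inl u → ⟦ A ⟧ u) × (∀ v → t ⟶* inr v → ⟦ B ⟧ v)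
⟦ A ⊙ B ⟧ t = SN t × (∀ u v → t ⟶* (u ⊕ v) → ⟦ A ⟧ u × ⟦ B ⟧ v)

{-# OPTIONS --safe #-}
module Submission where

open import Defs
open import Data.Product using (_×_; _,_; proj₁)
open import Induction.WellFounded using (acc)
open import Relation.Binary.Construct.Closure.ReflexiveTransitive using (ε; _◅_)

-- No rule has a sum at the root of its left-hand side, so a sum only reduces
-- inside its summands; reducibility is stable under reduction, and a sum of
-- strongly terminating terms strongly terminates by induction on both summands.

SN-⟶ : ∀ {n} {t t′ : Term n} → SN t → t ⟶ t′ → SN t′
SN-⟶ (acc rs) s = rs s

⟦⟧⇒SN : ∀ A {n} {t : Term n} → ⟦ A ⟧ t → SN t
⟦⟧⇒SN ⊤′      p = p
⟦⟧⇒SN ⊥′      p = p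
⟦⟧⇒SN (A ⇒ B) p = proj₁ p
⟦⟧⇒SN (A ∧ B) p = proj₁ p
⟦⟧⇒SN (A ∨ B) p = proj₁ p
⟦⟧⇒SN (A ⊙ B) p = proj₁ p

⟦⟧-⟶ : ∀ A {n} {t t′ : Term n} → ⟦ A ⟧ t → t ⟶ t′ → ⟦ A ⟧ t′
⟦⟧-⟶ ⊤′      p              s = SN-⟶ p s
⟦⟧-⟶ ⊥′      p              s = SN-⟶ p s
⟦⟧-⟶ (A ⇒ B) (sn , onLam)   s = SN-⟶ sn s , λ u r → onLam u (s ◅ r)
⟦⟧-⟶ (A ∧ B) (sn , onPair)  s = SN-⟶ sn s , λ u v r → onPair u v (s ◅ r)
⟦⟧-⟶ (A ∨ B) (sn , onL , onR) s =
  SN-⟶ sn s , (λ u r → onL u (s ◅ r)) , (λ v r → onR v (s ◅ r))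
⟦⟧-⟶ (A ⊙ B) (sn , onSum)   s = SN-⟶ sn s , λ u v r → onSum u v (s ◅ r)

⟦⟧-⟶* : ∀ A {n} {t t′ : Term n} → ⟦ A ⟧ t → t ⟶* t′ → ⟦ A ⟧ t′
⟦⟧-⟶* A p ε       = p
⟦⟧-⟶* A p (s ◅ r) = ⟦⟧-⟶* A (⟦⟧-⟶ A p s) r

⊕-⟶*-inv : ∀ {n} {t u a b : Term n} → t ⊕ u ⟶* a ⊕ b → t ⟶* a × u ⟶* b
⊕-⟶*-inv ε = ε , ε
⊕-⟶*-inv (⊕₁ s ◅ r) with ⊕-⟶*-inv r
... | rt , ru = s ◅ rt , ru
⊕-⟶*-inv (⊕₂ s ◅ r) with ⊕-⟶*-inv r
... | rt , ru = rt , s ◅ ru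

SN-⊕ : ∀ {n} {t u : Term n} → SN t → SN u → SN (t ⊕ u)
SN-⊕ (acc rt) (acc ru) = acc λ where
  (⊕₁ s) → SN-⊕ (rt s) (acc ru)
  (⊕₂ s) → SN-⊕ (acc rt) (ru s)

mainTheorem7 : ∀ (A B : Prop) {n} (t₁ t₂ : Term n) → ⟦ A ⟧ t₁ → ⟦ B ⟧ t₂ → ⟦ A ⊙ B ⟧ (t₁ ⊕ t₂)
mainTheorem7 A B t₁ t₂ p q = SN-⊕ (⟦⟧⇒SN A p) (⟦⟧⇒SN B q) , reducibleSummands
  where
  reducibleSummands : ∀ u v → t₁ ⊕ t₂ ⟶* u ⊕ v → ⟦ A ⟧ u × ⟦ B ⟧ v
  reducibleSummands u v r with ⊕-⟶*-inv r
  ... | r₁ , r₂ = ⟦⟧-⟶* A p r₁ , ⟦⟧-⟶* B q r₂
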